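{- Let $b_1,b_2,b_3,b_4\in\mathbb Z_2\setminus\{0\}$ with $(\operatorname{ord}_2(b_1),\operatorname{ord}_2(b_2),\operatorname{ord}_2(b_3),\operatorname{ord}_2(b_4))\in\Delta_2$, where $$\Delta_2=\{(1,1,1,1),(1,1,1,2),(1,1,1,3),(1,1,2,2),(1,1,2,3),(1,1,2,4),(1,2,2,3),(1,2,3,3),(1,2,3,4)\}.$$ Then the $\mathbb Z_2$-lattice $\langle b_1\rangle\perp\langle b_2\rangle\perp\langle b_3\rangle\perp\langle b_4\rangle$ is even universal.
   Context: $\langle b_1\rangle\perp\cdots\perp\langle b_4\rangle$ is the $\mathbb Z_2$-lattice with quadratic form $b_1y_1^2+b_2y_2^2+b_3y_3^2+b_4y_4^2$. A $\mathbb Z_2$-lattice is even universal if it represents every element of $2\mathbb Z_2$. $\operatorname{ord}_2$ is the $2$-adic valuation. -}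

module Defs where

open import Data.Nat using (ℕ; zero; suc; _+_; _*_; _^_; _<_; _%_)
open import Data.Nat.Properties using (m^n≢0)
open import Data.Product using (Σ; _×_; _,_; ∃)
open import Data.List using (List; []; _∷_)
open import Data.List.Membership.Propositional using (_∈_)
open import Relation.Binary.PropositionalEquality using (_≡_; _≢_)

_mod2^_ : ℕ → ℕ → ℕ
n mod2^ k = _%_ n (2 ^ k) {{m^n≢0 2 k}}

-- The ring of 2-adic integers ℤ₂ = lim ℤ/2^k ℤ : a 2-adic integer is a
-- coherent sequence of residues  x_k ∈ {0,…,2^k − 1}  with x_{k+1} ≡ x_k (mod 2^k).
record ℤ₂ : Set where
  constructor mkℤ₂
  field
    res       : ℕ → ℕ
    res-bound : ∀ k → res k < 2 ^ k
    res-coh   : ∀ k → (res (suc k)) mod2^ k ≡ res k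
open ℤ₂ public

_≈₂_ : ℤ₂ → ℤ₂ → Set
x ≈₂ y = ∀ k → res x k ≡ res y k

-- ord₂ x ≡ n  (for x ≠ 0): 2^n ∣ x but 2^(n+1) ∤ x.
-- Stated as a relation since ord₂ is undefined at 0; HasOrd₂ x n implies x ≠ 0.
HasOrd₂ : ℤ₂ → ℕ → Set
HasOrd₂ x n = (res x n ≡ 0) × (res x (suc n) ≢ 0)

-- Residue mod 2^k of the value  b₁y₁² + b₂y₂² + b₃y₃² + b₄y₄²  of the diagonal form
-- (reduction mod 2^k is a ring homomorphism ℤ₂ → ℤ/2^k).
diag4-res : (b₁ b₂ b₃ b₄ y₁ y₂ y₃ y₄ : ℤ₂) → ℕ → ℕ
diag4-res b₁ b₂ b₃ b₄ y₁ y₂ y₃ y₄ k =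
  (res b₁ k * (res y₁ k * res y₁ k) + res b₂ k * (res y₂ k * res y₂ k)
   + res b₃ k * (res y₃ k * res y₃ k) + res b₄ k * (res y₄ k * res y₄ k)) mod2^ k

Represents4 : (b₁ b₂ b₃ b₄ a : ℤ₂) → Set
Represents4 b₁ b₂ b₃ b₄ a =
  Σ ℤ₂ λ y₁ → Σ ℤ₂ λ y₂ → Σ ℤ₂ λ y₃ → Σ ℤ₂ λ y₄ →
    ∀ k → diag4-res b₁ b₂ b₃ b₄ y₁ y₂ y₃ y₄ k ≡ res a k

Even₂ : ℤ₂ → Set
Even₂ a = res a 1 ≡ 0

EvenUniversal4 : (b₁ b₂ b₃ b₄ : ℤ₂) → Set
EvenUniversal4 b₁ b₂ b₃ b₄ = (a : ℤ₂) → Even₂ a → Represents4 b₁ b₂ b₃ b₄ a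

record Quad : Set where
  constructor ⟨_,_,_,_⟩
  field q₁ q₂ q₃ q₄ : ℕ

Δ₂ : List Quad
Δ₂ = ⟨ 1 , 1 , 1 , 1 ⟩ ∷ ⟨ 1 , 1 , 1 , 2 ⟩ ∷ ⟨ 1 , 1 , 1 , 3 ⟩ ∷ ⟨ 1 , 1 , 2 , 2 ⟩
   ∷ ⟨ 1 , 1 , 2 , 3 ⟩ ∷ ⟨ 1 , 1 , 2 , 4 ⟩ ∷ ⟨ 1 , 2 , 2 , 3 ⟩ ∷ ⟨ 1 , 2 , 3 , 3 ⟩
   ∷ ⟨ 1 , 2 , 3 , 4 ⟩ ∷ []

{-# OPTIONS --safe #-}
module Submission where

-- Write a = 4^j A with ord₂ A ∈ {1, 2}. For every pattern of orders in Δ₂, a finite computation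
-- finds, for all coefficients modulo 32 and all such A modulo 32, a vector y and a pivot index i
-- with y_i odd and Σ b_k y_k² ≡ A modulo 2^(ord₂ b_i + 3). Hensel's lemma at the pivot lifts 2^j y
-- to a 2-adic solution for a: at each level either y already works, or adding a suitable power of
-- two to y_i changes the value by exactly the missing 2^N. Since a = 0 cannot be decided, the
-- scale j is located lazily: until it shows up in the digits of a, the zero vector is a solution.

open import Defs
open import Data.Nat using (ℕ)
open import Data.List.Membership.Propositional using (_∈_)

open import Data.Bool using (Bool; T; T?; _∧_)
open import Data.Bool.ListAction using (any)
open import Data.Bool.Properties using (T-∧)
open import Data.Empty using (⊥-elim)
open import Data.Fin using (Fin; zero; suc)
open import Data.List using (List; upTo; concatMap; cartesianProduct; filterᵇ; allFin)
  renaming (map to mapˡ; [_] to [_]ˡ)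
import Data.List.Relation.Unary.All as ListAll
open import Data.List.Relation.Unary.Any using (satisfied)
open import Data.List.Relation.Unary.Any.Properties using (any⁻)
open import Data.Nat
  using (zero; suc; _+_; _*_; _^_; _∸_; _≤_; _<_; _⊓_; _⊔_; _/_; _%_; z≤n; s≤s; _≟_; _≡ᵇ_)
open import Data.Nat.DivMod
open import Data.Nat.Divisibility
  using (_∣_; divides; ∣-refl; ∣-trans; m∣m*n; *-pres-∣; ∣m∣n⇒∣m+n; n∣m⇒m%n≡0)
open import Data.Nat.Properties
open import Data.Nat.Tactic.RingSolver using (solve-∀)
open import Data.Product using (Σ; Σ-syntax; _×_; _,_; proj₁; proj₂)
open import Data.Sum using (_⊎_; inj₁; inj₂)
open import Data.Vec using (Vec; []; _∷_; lookup; map; replicate; updateAt; tabulate; zip)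
open import Data.Vec.Properties using (lookup-map; lookup∘updateAt)
open import Data.Vec.Relation.Binary.Pointwise.Inductive as Pointwise using (Pointwise; []; _∷_)
open import Data.Vec.Relation.Unary.All as All using (All; []; _∷_)
open import Data.Vec.Relation.Unary.All.Properties using (map⁺)
open import Function.Base using (_∘_)
open import Function.Bundles using (Equivalence)
open import Relation.Binary.Bundles using (Setoid)
open import Relation.Binary.PropositionalEquality
  using (_≡_; _≢_; refl; sym; trans; cong; cong₂; subst; module ≡-Reasoning)
import Relation.Binary.Reasoning.Setoid as SetoidReasoning
open import Relation.Binary.Structures using (IsEquivalence)
open import Relation.Nullary using (¬_; Dec; yes; no)
open import Relation.Nullary.Decidable using (map′; _×-dec_; _⊎-dec_; _→-dec_; ¬?; toWitness)

-- Congruence modulo powers of two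

-- A record, so that x, y and k can be recovered by unification.
infix 4 _≡_[mod2^_]
record _≡_[mod2^_] (x y k : ℕ) : Set where
  constructor mod-≡
  field residues-≡ : x mod2^ k ≡ y mod2^ k
open _≡_[mod2^_] public

module _ {k : ℕ} where

  ≡mod-isEquivalence : IsEquivalence (λ x y → x ≡ y [mod2^ k ])
  ≡mod-isEquivalence = record
    { refl = mod-≡ refl
    ; sym = λ (mod-≡ e) → mod-≡ (sym e)
    ; trans = λ (mod-≡ e) (mod-≡ f) → mod-≡ (trans e f)
    }

  open IsEquivalence ≡mod-isEquivalence public
    renaming (refl to ≡mod-refl; sym to ≡mod-sym; trans to ≡mod-trans; reflexive to ≡⇒≡mod)

mod2^-setoid : ℕ → Setoid _ _
mod2^-setoid k = record { isEquivalence = ≡mod-isEquivalence {k} }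

module ≡mod-Reasoning (k : ℕ) = SetoidReasoning (mod2^-setoid k)

infix 4 _≡mod?_
_≡mod?_ : ∀ {k} x y → Dec (x ≡ y [mod2^ k ])
x ≡mod? y = map′ mod-≡ residues-≡ (_ ≟ _)

mod2^-≡mod : ∀ k x → x mod2^ k ≡ x [mod2^ k ]
mod2^-≡mod k x = mod-≡ (m%n%n≡m%n x (2 ^ k))
  where instance _ = m^n≢0 2 k

<2^⇒mod2^≡ : ∀ {k x} → x < 2 ^ k → x mod2^ k ≡ x
<2^⇒mod2^≡ {k} = m<n⇒m%n≡m
  where instance _ = m^n≢0 2 k

2^∣2^ : ∀ {m n} → m ≤ n → 2 ^ m ∣ 2 ^ n
2^∣2^ {m} {n} m≤n with m≤n⇒∃[o]m+o≡n m≤n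
... | o , refl = divides (2 ^ o) (trans (^-distribˡ-+-* 2 m o) (*-comm (2 ^ m) (2 ^ o)))

mod2^-mod2^ : ∀ {k n} x → k ≤ n → (x mod2^ n) mod2^ k ≡ x mod2^ k
mod2^-mod2^ {k} {n} x k≤n = m∣n⇒o%n%m≡o%m (2 ^ k) (2 ^ n) x (2^∣2^ k≤n)
  where
  instance
    _ = m^n≢0 2 k
    _ = m^n≢0 2 n

≡mod-weaken : ∀ {k n x y} → k ≤ n → x ≡ y [mod2^ n ] → x ≡ y [mod2^ k ]
≡mod-weaken {k} {n} {x} {y} k≤n (mod-≡ e) = mod-≡ (begin
  x mod2^ k            ≡⟨ mod2^-mod2^ x k≤n ⟨
  (x mod2^ n) mod2^ k  ≡⟨ cong (_mod2^ k) e ⟩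
  (y mod2^ n) mod2^ k  ≡⟨ mod2^-mod2^ y k≤n ⟩
  y mod2^ k            ∎)
  where open ≡-Reasoning

+-cong-mod : ∀ {k x y u v} → x ≡ y [mod2^ k ] → u ≡ v [mod2^ k ] → x + u ≡ y + v [mod2^ k ]
+-cong-mod {k} {x} {y} {u} {v} (mod-≡ e) (mod-≡ f) = mod-≡ (begin
  (x + u) % 2 ^ k                    ≡⟨ %-distribˡ-+ x u (2 ^ k) ⟩
  (x % 2 ^ k + u % 2 ^ k) % 2 ^ k    ≡⟨ cong₂ (λ r s → (r + s) % 2 ^ k) e f ⟩
  (y % 2 ^ k + v % 2 ^ k) % 2 ^ k    ≡⟨ %-distribˡ-+ y v (2 ^ k) ⟨
  (y + v) % 2 ^ k                    ∎)
  where
  open ≡-Reasoning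
  instance _ = m^n≢0 2 k

*-cong-mod : ∀ {k x y u v} → x ≡ y [mod2^ k ] → u ≡ v [mod2^ k ] → x * u ≡ y * v [mod2^ k ]
*-cong-mod {k} {x} {y} {u} {v} (mod-≡ e) (mod-≡ f) = mod-≡ (begin
  (x * u) % 2 ^ k                      ≡⟨ %-distribˡ-* x u (2 ^ k) ⟩
  (x % 2 ^ k * (u % 2 ^ k)) % 2 ^ k    ≡⟨ cong₂ (λ r s → (r * s) % 2 ^ k) e f ⟩
  (y % 2 ^ k * (v % 2 ^ k)) % 2 ^ k    ≡⟨ %-distribˡ-* y v (2 ^ k) ⟨
  (y * v) % 2 ^ k                      ∎)
  where
  open ≡-Reasoning
  instance _ = m^n≢0 2 k

2^*-mod2^ : ∀ t k x → (2 ^ t * x) mod2^ (t + k) ≡ 2 ^ t * (x mod2^ k)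
2^*-mod2^ t k x = begin
  (2 ^ t * x) % 2 ^ (t + k)       ≡⟨ %-congʳ 2^[t+k]≡2^k*2^t ⟩
  (2 ^ t * x) % (2 ^ k * 2 ^ t)   ≡⟨ cong (_% (2 ^ k * 2 ^ t)) (*-comm (2 ^ t) x) ⟩
  (x * 2 ^ t) % (2 ^ k * 2 ^ t)   ≡⟨ m%n*o≡m*o%[n*o] x (2 ^ k) (2 ^ t) ⟨
  x % 2 ^ k * 2 ^ t               ≡⟨ *-comm (x % 2 ^ k) (2 ^ t) ⟩
  2 ^ t * (x % 2 ^ k)             ∎
  where
  open ≡-Reasoning
  instance
    _ = m^n≢0 2 k
    _ = m^n≢0 2 t
    _ = m^n≢0 2 (t + k)
    _ = m*n≢0 (2 ^ k) (2 ^ t)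
  2^[t+k]≡2^k*2^t : 2 ^ (t + k) ≡ 2 ^ k * 2 ^ t
  2^[t+k]≡2^k*2^t = trans (^-distribˡ-+-* 2 t k) (*-comm (2 ^ t) (2 ^ k))

2^*-cong-mod : ∀ {k x y} t → x ≡ y [mod2^ k ] → 2 ^ t * x ≡ 2 ^ t * y [mod2^ (t + k) ]
2^*-cong-mod {k} {x} {y} t (mod-≡ e) =
  mod-≡ (trans (2^*-mod2^ t k x) (trans (cong (2 ^ t *_) e) (sym (2^*-mod2^ t k y))))

∣⇒≡0-mod : ∀ {k x} → 2 ^ k ∣ x → x ≡ 0 [mod2^ k ]
∣⇒≡0-mod {k} {x} 2^k∣x = mod-≡ (trans (n∣m⇒m%n≡0 x (2 ^ k) 2^k∣x) (sym (m*n%n≡0 0 (2 ^ k))))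
  where instance _ = m^n≢0 2 k

mod2^-suc-split : ∀ N x → x mod2^ suc N ≡ x mod2^ N ⊎ x mod2^ suc N ≡ x mod2^ N + 2 ^ N
mod2^-suc-split N x with r / 2 ^ N | r≡low+q*2^N | r/2^N<2
  where
  instance
    _ = m^n≢0 2 N
    _ = m^n≢0 2 (suc N)
  r = x mod2^ suc N
  r≡low+q*2^N : r ≡ x mod2^ N + r / 2 ^ N * 2 ^ N
  r≡low+q*2^N = trans (m≡m%n+[m/n]*n r (2 ^ N)) (cong (_+ r / 2 ^ N * 2 ^ N) (mod2^-mod2^ x (n≤1+n N)))
  r/2^N<2 : r / 2 ^ N < 2
  r/2^N<2 = m<n*o⇒m/o<n (m%n<n x (2 ^ suc N))
... | 0 | e | _ = inj₁ (trans e (+-identityʳ _))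
... | 1 | e | _ = inj₂ (trans e (cong (x mod2^ N +_) (*-identityˡ (2 ^ N))))
... | suc (suc _) | _ | s≤s (s≤s ())

2^≡0-mod : ∀ k → 2 ^ k ≡ 0 [mod2^ k ]
2^≡0-mod k = ∣⇒≡0-mod (divides 1 (sym (*-identityˡ (2 ^ k))))

≡mod-suc-cases : ∀ {N x y} → x ≡ y [mod2^ N ] → x ≡ y [mod2^ suc N ] ⊎ x + 2 ^ N ≡ y [mod2^ suc N ]
≡mod-suc-cases {N} {x} {y} (mod-≡ e) with mod2^-suc-split N x | mod2^-suc-split N y
... | inj₁ ex | inj₁ ey = inj₁ (mod-≡ (trans ex (trans e (sym ey))))
... | inj₂ ex | inj₂ ey = inj₁ (mod-≡ (trans ex (trans (cong (_+ 2 ^ N) e) (sym ey))))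
... | inj₁ ex | inj₂ ey = inj₂ (begin
  x + 2 ^ N                ≈⟨ +-cong-mod (mod2^-≡mod (suc N) x) ≡mod-refl ⟨
  x mod2^ suc N + 2 ^ N    ≡⟨ cong (_+ 2 ^ N) (trans ex e) ⟩
  y mod2^ N + 2 ^ N        ≡⟨ ey ⟨
  y mod2^ suc N            ≈⟨ mod2^-≡mod (suc N) y ⟩
  y                        ∎)
  where open ≡mod-Reasoning (suc N)
... | inj₂ ex | inj₁ ey = inj₂ (begin
  x + 2 ^ N                      ≈⟨ +-cong-mod (mod2^-≡mod (suc N) x) ≡mod-refl ⟨
  x mod2^ suc N + 2 ^ N          ≡⟨ cong (_+ 2 ^ N) (trans ex (cong (_+ 2 ^ N) e)) ⟩
  y mod2^ N + 2 ^ N + 2 ^ N      ≡⟨ m+n+n≡m+2n (y mod2^ N) (2 ^ N) ⟩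
  y mod2^ N + 2 ^ suc N          ≈⟨ +-cong-mod ≡mod-refl (2^≡0-mod (suc N)) ⟩
  y mod2^ N + 0                  ≡⟨ trans (+-identityʳ _) (sym ey) ⟩
  y mod2^ suc N                  ≈⟨ mod2^-≡mod (suc N) y ⟩
  y                              ∎)
  where
  open ≡mod-Reasoning (suc N)
  m+n+n≡m+2n : ∀ m n → m + n + n ≡ m + 2 * n
  m+n+n≡m+2n = solve-∀

≡mod-suc-correct : ∀ {N x y u v} → x ≡ y [mod2^ N ] → ¬ x ≡ y [mod2^ suc N ] →
  u ≡ 2 ^ N [mod2^ suc N ] → v ≡ 0 [mod2^ suc N ] → x + (u + v) ≡ y [mod2^ suc N ]
≡mod-suc-correct {N} {x} {y} {u} {v} x≡y x≢y u≡2^N v≡0 with ≡mod-suc-cases x≡y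
... | inj₁ x≡y′ = ⊥-elim (x≢y x≡y′)
... | inj₂ x+2^N≡y = begin
  x + (u + v)         ≈⟨ +-cong-mod (≡mod-refl {x = x}) (+-cong-mod u≡2^N v≡0) ⟩
  x + (2 ^ N + 0)     ≡⟨ cong (x +_) (+-identityʳ (2 ^ N)) ⟩
  x + 2 ^ N           ≈⟨ x+2^N≡y ⟩
  y                   ∎
  where open ≡mod-Reasoning (suc N)

infix 4 2^_∥_
record 2^_∥_ (j x : ℕ) : Set where
  constructor exactly
  field
    odd-part : ℕ
    factorisation : x ≡ 2 ^ j * (1 + 2 * odd-part)

2^<2^suc : ∀ j → 2 ^ j < 2 ^ suc j
2^<2^suc j = ^-monoʳ-< 2 (s≤s (s≤s z≤n)) (n<1+n j)

∥⇒∣ : ∀ {j x} → 2^ j ∥ x → 2 ^ j ∣ x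
∥⇒∣ {j} (exactly u refl) = divides (1 + 2 * u) (*-comm (2 ^ j) (1 + 2 * u))

∥⇒≡2^-mod : ∀ {j x} → 2^ j ∥ x → x ≡ 2 ^ j [mod2^ suc j ]
∥⇒≡2^-mod {j} (exactly u refl) = mod-≡ (begin
  (2 ^ j * (1 + 2 * u)) % 2 ^ suc j      ≡⟨ cong (_% 2 ^ suc j) (split (2 ^ j) u) ⟩
  (2 ^ j + u * 2 ^ suc j) % 2 ^ suc j    ≡⟨ [m+kn]%n≡m%n (2 ^ j) u (2 ^ suc j) ⟩
  2 ^ j % 2 ^ suc j                      ∎)
  where
  open ≡-Reasoning
  instance _ = m^n≢0 2 (suc j)
  split : ∀ p u → p * (1 + 2 * u) ≡ p + u * (2 * p)
  split = solve-∀

≡2^-mod⇒∥ : ∀ {j x} → x ≡ 2 ^ j [mod2^ suc j ] → 2^ j ∥ x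
≡2^-mod⇒∥ {j} {x} (mod-≡ e) = exactly (x / 2 ^ suc j) (begin
  x                                            ≡⟨ m≡m%n+[m/n]*n x (2 ^ suc j) ⟩
  x % 2 ^ suc j + x / 2 ^ suc j * 2 ^ suc j
    ≡⟨ cong (_+ x / 2 ^ suc j * 2 ^ suc j) (trans e (<2^⇒mod2^≡ {suc j} (2^<2^suc j))) ⟩
  2 ^ j + x / 2 ^ suc j * (2 * 2 ^ j)          ≡⟨ merge (2 ^ j) (x / 2 ^ suc j) ⟩
  2 ^ j * (1 + 2 * (x / 2 ^ suc j))            ∎)
  where
  open ≡-Reasoning
  instance _ = m^n≢0 2 (suc j)
  merge : ∀ p u → p + u * (2 * p) ≡ p * (1 + 2 * u)
  merge = solve-∀

2^∥2^ : ∀ j → 2^ j ∥ 2 ^ j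
2^∥2^ j = exactly 0 (sym (*-identityʳ (2 ^ j)))

∥-* : ∀ {a c x y} → 2^ a ∥ x → 2^ c ∥ y → 2^ (a + c) ∥ x * y
∥-* {a} {c} (exactly u refl) (exactly w refl) = exactly (u + w + 2 * u * w) (begin
  2 ^ a * (1 + 2 * u) * (2 ^ c * (1 + 2 * w))       ≡⟨ regroup (2 ^ a) (2 ^ c) u w ⟩
  2 ^ a * 2 ^ c * (1 + 2 * (u + w + 2 * u * w))     ≡⟨ cong (_* _) (^-distribˡ-+-* 2 a c) ⟨
  2 ^ (a + c) * (1 + 2 * (u + w + 2 * u * w))       ∎)
  where
  open ≡-Reasoning
  regroup : ∀ p q u w → p * (1 + 2 * u) * (q * (1 + 2 * w)) ≡ p * q * (1 + 2 * (u + w + 2 * u * w))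
  regroup = solve-∀

∥-+ : ∀ {j x d} → 2^ j ∥ x → 2 ^ suc j ∣ d → 2^ j ∥ x + d
∥-+ {j} (exactly u refl) (divides w refl) = exactly (u + w) (merge (2 ^ j) u w)
  where
  merge : ∀ p u w → p * (1 + 2 * u) + w * (2 * p) ≡ p * (1 + 2 * (u + w))
  merge = solve-∀

2^*≡0⇒≡0 : ∀ t {x} → 2 ^ t * x ≡ 0 → x ≡ 0
2^*≡0⇒≡0 t {x} e = *-cancelˡ-≡ x 0 (2 ^ t) {{m^n≢0 2 t}} (trans e (sym (*-zeroʳ (2 ^ t))))

-- 2-adic integers

res-mod2^ : ∀ (x : ℤ₂) k → res x k mod2^ k ≡ res x k
res-mod2^ x k = <2^⇒mod2^≡ {k} (res-bound x k)

res-suc-≡mod : ∀ (x : ℤ₂) k → res x (suc k) ≡ res x k [mod2^ k ]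
res-suc-≡mod x k = mod-≡ (trans (res-coh x k) (sym (res-mod2^ x k)))

res-≡mod : ∀ (x : ℤ₂) {k n} → k ≤ n → res x n ≡ res x k [mod2^ k ]
res-≡mod x {k} k≤n with m≤n⇒∃[o]m+o≡n k≤n
... | t , refl = go t
  where
  go : ∀ t → res x (k + t) ≡ res x k [mod2^ k ]
  go zero = ≡⇒≡mod (cong (res x) (+-identityʳ k))
  go (suc t) = ≡mod-trans (≡mod-weaken (m≤m+n k t) (subst (λ n → res x n ≡ res x (k + t) [mod2^ k + t ])
    (sym (+-suc k t)) (res-suc-≡mod x (k + t)))) (go t)

HasOrd₂⇒res-suc : ∀ {x o} → HasOrd₂ x o → res x (suc o) ≡ 2 ^ o
HasOrd₂⇒res-suc {x} {o} (res≡0 , res-suc≢0) with mod2^-suc-split o (res x (suc o))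
... | inj₁ e = ⊥-elim (res-suc≢0 (trans (sym (res-mod2^ x (suc o))) (trans e low≡0)))
  where low≡0 = trans (res-coh x o) res≡0
... | inj₂ e = trans (sym (res-mod2^ x (suc o))) (trans e (cong (_+ 2 ^ o) low≡0))
  where low≡0 = trans (res-coh x o) res≡0

HasOrd₂⇒∥ : ∀ {x o n} → HasOrd₂ x o → suc o ≤ n → 2^ o ∥ res x n
HasOrd₂⇒∥ {x} {o} ord o<n =
  ≡2^-mod⇒∥ {o} (≡mod-trans (res-≡mod x o<n) (≡⇒≡mod (HasOrd₂⇒res-suc {x} {o} ord)))

res-mod2^-≤ : ∀ (x : ℤ₂) {k n} → k ≤ n → res x n mod2^ k ≡ res x k
res-mod2^-≤ x {k} k≤n = trans (residues-≡ (res-≡mod x k≤n)) (res-mod2^ x k)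

_/2^_ : ℤ₂ → ℕ → ℤ₂
x /2^ t = mkℤ₂ (λ k → res x (t + k) / 2 ^ t) bound coherent
  where
  instance _ = m^n≢0 2 t
  bound : ∀ k → res x (t + k) / 2 ^ t < 2 ^ k
  bound k = m<n*o⇒m/o<n
    (subst (res x (t + k) <_) (trans (^-distribˡ-+-* 2 t k) (*-comm (2 ^ t) (2 ^ k))) (res-bound x (t + k)))
  coherent : ∀ k → (res x (t + suc k) / 2 ^ t) mod2^ k ≡ res x (t + k) / 2 ^ t
  coherent k = begin
    (res x (t + suc k) / 2 ^ t) % 2 ^ k            ≡⟨ m%[n*o]/o≡m/o%n (res x (t + suc k)) (2 ^ k) (2 ^ t) ⟨
    (res x (t + suc k) % (2 ^ k * 2 ^ t)) / 2 ^ t  ≡⟨ cong (_/ 2 ^ t) (%-congʳ 2^k*2^t≡2^[t+k]) ⟩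
    (res x (t + suc k) mod2^ (t + k)) / 2 ^ t     ≡⟨ cong (λ n → (res x n mod2^ (t + k)) / 2 ^ t) (+-suc t k) ⟩
    (res x (suc (t + k)) mod2^ (t + k)) / 2 ^ t   ≡⟨ cong (_/ 2 ^ t) (res-coh x (t + k)) ⟩
    res x (t + k) / 2 ^ t                         ∎
    where
    open ≡-Reasoning
    instance
      _ = m^n≢0 2 k
      _ = m^n≢0 2 (t + k)
      _ = m*n≢0 (2 ^ k) (2 ^ t)
    2^k*2^t≡2^[t+k] : 2 ^ k * 2 ^ t ≡ 2 ^ (t + k)
    2^k*2^t≡2^[t+k] = trans (*-comm (2 ^ k) (2 ^ t)) (sym (^-distribˡ-+-* 2 t k))

res-/2^ : ∀ x t → res x t ≡ 0 → ∀ k → res x (t + k) ≡ 2 ^ t * res (x /2^ t) k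
res-/2^ x t res≡0 k = begin
  res x (t + k)                                   ≡⟨ m≡m%n+[m/n]*n (res x (t + k)) (2 ^ t) ⟩
  res x (t + k) % 2 ^ t + res x (t + k) / 2 ^ t * 2 ^ t
    ≡⟨ cong (_+ res x (t + k) / 2 ^ t * 2 ^ t) (trans (res-mod2^-≤ x (m≤m+n t k)) res≡0) ⟩
  res x (t + k) / 2 ^ t * 2 ^ t                   ≡⟨ *-comm _ (2 ^ t) ⟩
  2 ^ t * (res x (t + k) / 2 ^ t)                 ∎
  where
  open ≡-Reasoning
  instance _ = m^n≢0 2 t

fromCoherent : (f : ℕ → ℕ) → (∀ k → f (suc k) ≡ f k [mod2^ k ]) → ℤ₂
fromCoherent f coh = mkℤ₂ (λ k → f k mod2^ k) (λ k → m%n<n (f k) (2 ^ k) {{m^n≢0 2 k}})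
  (λ k → trans (mod2^-mod2^ (f (suc k)) (n≤1+n k)) (residues-≡ (coh k)))

infix 4 _≋_[mod2^_]
_≋_[mod2^_] : ∀ {n} → Vec ℕ n → Vec ℕ n → ℕ → Set
ys ≋ zs [mod2^ k ] = Pointwise (λ y z → y ≡ z [mod2^ k ]) ys zs

≋mod-refl : ∀ {n k} {ys : Vec ℕ n} → ys ≋ ys [mod2^ k ]
≋mod-refl = Pointwise.refl ≡mod-refl

diag : ∀ {n} → Vec ℕ n → Vec ℕ n → ℕ
diag [] [] = 0
diag (b ∷ bs) (y ∷ ys) = b * (y * y) + diag bs ys

diag-cong-mod : ∀ {n k} {bs bs′ ys ys′ : Vec ℕ n} →
  bs ≋ bs′ [mod2^ k ] → ys ≋ ys′ [mod2^ k ] → diag bs ys ≡ diag bs′ ys′ [mod2^ k ]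
diag-cong-mod [] [] = ≡mod-refl
diag-cong-mod (b≡b′ ∷ bs≋bs′) (y≡y′ ∷ ys≋ys′) =
  +-cong-mod (*-cong-mod b≡b′ (*-cong-mod y≡y′ y≡y′)) (diag-cong-mod bs≋bs′ ys≋ys′)

diag-replicate-0 : ∀ {n} (bs : Vec ℕ n) → diag bs (replicate n 0) ≡ 0
diag-replicate-0 [] = refl
diag-replicate-0 (b ∷ bs) = trans (cong (_+ diag bs (replicate _ 0)) (*-zeroʳ b)) (diag-replicate-0 bs)

diag-scale : ∀ {n} s (bs ys : Vec ℕ n) → diag bs (map (s *_) ys) ≡ s * s * diag bs ys
diag-scale s [] [] = sym (*-zeroʳ (s * s))
diag-scale s (b ∷ bs) (y ∷ ys) =
  trans (cong (b * (s * y * (s * y)) +_) (diag-scale s bs ys)) (distrib s b y (diag bs ys))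
  where
  distrib : ∀ s b y q → b * (s * y * (s * y)) + s * s * q ≡ s * s * (b * (y * y) + q)
  distrib = solve-∀

diag-updateAt : ∀ {n} (bs ys : Vec ℕ n) i d → diag bs (updateAt ys i (_+ d)) ≡
  diag bs ys + (lookup bs i * (lookup ys i * (2 * d)) + lookup bs i * (d * d))
diag-updateAt (b ∷ bs) (y ∷ ys) zero d = expand b y d (diag bs ys)
  where
  expand : ∀ b y d q → b * ((y + d) * (y + d)) + q ≡ b * (y * y) + q + (b * (y * (2 * d)) + b * (d * d))
  expand = solve-∀
diag-updateAt (b ∷ bs) (y ∷ ys) (suc i) d =
  trans (cong (b * (y * y) +_) (diag-updateAt bs ys i d)) (sym (+-assoc (b * (y * y)) _ _))

updateAt-+-≋ : ∀ {n k d} (ys : Vec ℕ n) i → d ≡ 0 [mod2^ k ] → updateAt ys i (_+ d) ≋ ys [mod2^ k ]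
updateAt-+-≋ (y ∷ ys) zero d≡0 =
  ≡mod-trans (+-cong-mod (≡mod-refl {x = y}) d≡0) (≡⇒≡mod (+-identityʳ y)) ∷ ≋mod-refl
updateAt-+-≋ (y ∷ ys) (suc i) d≡0 = ≡mod-refl ∷ updateAt-+-≋ ys i d≡0

All-updateAt⁺ : ∀ {A : Set} {P : A → Set} {n} {xs : Vec A n} i {f : A → A} →
  (∀ {x} → P x → P (f x)) → All P xs → All P (updateAt xs i f)
All-updateAt⁺ zero f-pres (px ∷ pxs) = f-pres px ∷ pxs
All-updateAt⁺ (suc i) f-pres (px ∷ pxs) = px ∷ All-updateAt⁺ i f-pres pxs

tabulate-mod2^-≋ : ∀ {n k} (v : Vec ℕ n) → tabulate (λ m → lookup v m mod2^ k) ≋ v [mod2^ k ]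
tabulate-mod2^-≋ [] = []
tabulate-mod2^-≋ {k = k} (x ∷ v) = mod2^-≡mod k x ∷ tabulate-mod2^-≋ v

All-∣⇒≋0 : ∀ {n j k} {ys : Vec ℕ n} → k ≤ j → All (2 ^ j ∣_) ys → ys ≋ replicate n 0 [mod2^ k ]
All-∣⇒≋0 k≤j [] = []
All-∣⇒≋0 k≤j (2^j∣y ∷ rest) = ∣⇒≡0-mod (∣-trans (2^∣2^ k≤j) 2^j∣y) ∷ All-∣⇒≋0 k≤j rest

residues : ∀ {n} → Vec ℤ₂ n → ℕ → Vec ℕ n
residues bs k = map (λ b → res b k) bs

residues-≋ : ∀ {m k n} (bs : Vec ℤ₂ m) → k ≤ n → residues bs n ≋ residues bs k [mod2^ k ]
residues-≋ [] k≤n = []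
residues-≋ (b ∷ bs) k≤n = res-≡mod b k≤n ∷ residues-≋ bs k≤n

SolutionMod2^ : ∀ {n} → Vec ℤ₂ n → ℤ₂ → ℕ → Vec ℕ n → Set
SolutionMod2^ bs a k ys = diag (residues bs k) ys ≡ res a k [mod2^ k ]

solution-weaken : ∀ {m k n} {bs : Vec ℤ₂ m} {a ys} → k ≤ n → SolutionMod2^ bs a n ys → SolutionMod2^ bs a k ys
solution-weaken {bs = bs} {a} k≤n sol =
  ≡mod-trans (diag-cong-mod (Pointwise.sym ≡mod-sym (residues-≋ bs k≤n)) ≋mod-refl)
  (≡mod-trans (≡mod-weaken k≤n sol) (res-≡mod a k≤n))

solution-2^* : ∀ {m} {bs : Vec ℤ₂ m} {a ys} j p → res a (j + j) ≡ 0 →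
  SolutionMod2^ bs (a /2^ (j + j)) p ys → SolutionMod2^ bs a (j + j + p) (map (2 ^ j *_) ys)
solution-2^* {bs = bs} {a} {ys} j p res≡0 sol = begin
  diag (residues bs (j + j + p)) (map (2 ^ j *_) ys)     ≡⟨ diag-scale (2 ^ j) (residues bs (j + j + p)) ys ⟩
  2 ^ j * 2 ^ j * diag (residues bs (j + j + p)) ys      ≡⟨ cong (_* diag (residues bs (j + j + p)) ys) (^-distribˡ-+-* 2 j j) ⟨
  2 ^ (j + j) * diag (residues bs (j + j + p)) ys
    ≈⟨ 2^*-cong-mod (j + j) (≡mod-trans (diag-cong-mod (residues-≋ bs (m≤n+m p (j + j))) ≋mod-refl) sol) ⟩
  2 ^ (j + j) * res (a /2^ (j + j)) p                    ≡⟨ res-/2^ a (j + j) res≡0 p ⟨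
  res a (j + j + p)                                      ∎
  where open ≡mod-Reasoning (j + j + p)

-- Hensel lifting at a pivot coordinate

module HenselLift {n} (bs : Vec ℤ₂ n) (a : ℤ₂) (i : Fin n) {o : ℕ} (ord : HasOrd₂ (lookup bs i) o) (j : ℕ)
  where

  -- The offset 2j + o + 3 is what makes the square of the correction vanish modulo 2^(N+1) below.
  level : ℕ → ℕ
  level t = t + (j + j + (o + 3))

  record Approx (t : ℕ) (ys : Vec ℕ n) : Set where
    field
      solution : SolutionMod2^ bs a (level t) ys
      pivot-∥ : 2^ j ∥ lookup ys i
      all-∣ : All (2 ^ j ∣_) ys

  -- Adding D to the pivot coordinate adds B (2 y_i D) + B D² to the value, where the first term is
  -- exactly divisible by 2^N and the second is divisible by 2^(N+1).
  approx-step : ∀ {t ys} → Approx t ys → Σ[ ys′ ∈ Vec ℕ n ] Approx (suc t) ys′ × ys′ ≋ ys [mod2^ t ]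
  approx-step {t} {ys} approx = lift (diag (residues bs (suc N)) ys ≡mod? res a (suc N))
    where
    open Approx approx
    N = level t
    e = t + (2 + j)
    D = 2 ^ e
    B = lookup (residues bs (suc N)) i

    B-∥ : 2^ o ∥ B
    B-∥ = subst (2^ o ∥_) (sym (lookup-map i (λ b → res b (suc N)) bs))
      (HasOrd₂⇒∥ {lookup bs i} ord (s≤s (≤-trans (m≤m+n o 3) (≤-trans (m≤n+m (o + 3) (j + j)) (m≤n+m _ t)))))

    solution-mod-N : diag (residues bs (suc N)) ys ≡ res a (suc N) [mod2^ N ]
    solution-mod-N = ≡mod-trans (diag-cong-mod (residues-≋ bs (n≤1+n N)) ≋mod-refl)
      (≡mod-trans solution (≡mod-sym (res-suc-≡mod a N)))

    cross-term-∥ : 2^ N ∥ B * (lookup ys i * (2 * D))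
    cross-term-∥ = subst (2^_∥ B * (lookup ys i * (2 * D))) (exponent o j t)
      (∥-* B-∥ (∥-* pivot-∥ (2^∥2^ (suc e))))
      where
      exponent : ∀ o j t → o + (j + suc (t + (2 + j))) ≡ t + (j + j + (o + 3))
      exponent = solve-∀

    square-term-∣ : 2 ^ suc N ∣ B * (D * D)
    square-term-∣ = ∣-trans (2^∣2^ (≤-trans (m≤m+n (suc N) t) (≤-reflexive (exponent o j t))))
      (subst (_∣ B * (D * D)) (2^[o+e+e] o e) (*-pres-∣ (∥⇒∣ B-∥) ∣-refl))
      where
      exponent : ∀ o j t → suc (t + (j + j + (o + 3))) + t ≡ o + (t + (2 + j) + (t + (2 + j)))
      exponent = solve-∀
      2^[o+e+e] : ∀ o e → 2 ^ o * (2 ^ e * 2 ^ e) ≡ 2 ^ (o + (e + e))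
      2^[o+e+e] o e = sym (trans (^-distribˡ-+-* 2 o (e + e)) (cong (2 ^ o *_) (^-distribˡ-+-* 2 e e)))

    lift : Dec (SolutionMod2^ bs a (suc N) ys) → Σ[ ys′ ∈ Vec ℕ n ] Approx (suc t) ys′ × ys′ ≋ ys [mod2^ t ]
    lift (yes solution′) = ys , record { solution = solution′ ; pivot-∥ = pivot-∥ ; all-∣ = all-∣ } , ≋mod-refl
    lift (no ¬solution′) = ys′ , record { solution = solution′ ; pivot-∥ = pivot-∥′ ; all-∣ = all-∣′ } ,
      updateAt-+-≋ ys i (∣⇒≡0-mod (2^∣2^ (m≤m+n t (2 + j))))
      where
      ys′ = updateAt ys i (_+ D)

      solution′ : SolutionMod2^ bs a (suc N) ys′
      solution′ = ≡mod-trans (≡⇒≡mod (diag-updateAt (residues bs (suc N)) ys i D))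
        (≡mod-suc-correct solution-mod-N ¬solution′ (∥⇒≡2^-mod cross-term-∥) (∣⇒≡0-mod square-term-∣))

      pivot-∥′ : 2^ j ∥ lookup ys′ i
      pivot-∥′ = subst (2^ j ∥_) (sym (lookup∘updateAt i ys))
        (∥-+ pivot-∥ (2^∣2^ (≤-trans (n≤1+n (suc j)) (m≤n+m (2 + j) t))))

      all-∣′ : All (2 ^ j ∣_) ys′
      all-∣′ = All-updateAt⁺ i (λ 2^j∣y → ∣m∣n⇒∣m+n 2^j∣y 2^j∣D) all-∣
        where 2^j∣D = 2^∣2^ (≤-trans (m≤n+m j 2) (m≤n+m (2 + j) t))

  lifted : ∀ {ys} → Approx 0 ys → ∀ t → Σ (Vec ℕ n) (Approx t)
  lifted base zero = _ , base
  lifted base (suc t) = proj₁ next , proj₁ (proj₂ next)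
    where next = approx-step (proj₂ (lifted base t))

  lifted-≋ : ∀ {ys} (base : Approx 0 ys) t → proj₁ (lifted base (suc t)) ≋ proj₁ (lifted base t) [mod2^ t ]
  lifted-≋ base t = proj₂ (proj₂ (approx-step (proj₂ (lifted base t))))

-- The finite certificate

vectorsBelow : ∀ {n} → Vec ℕ n → List (Vec ℕ n)
vectorsBelow [] = [ [] ]ˡ
vectorsBelow (m ∷ ms) = concatMap (λ y → mapˡ (y ∷_) (vectorsBelow ms)) (upTo m)

isPivotSolution : ∀ {n} → ℕ → Vec ℕ n → Vec ℕ n → ℕ → Fin n × Vec ℕ n → Bool
isPivotSolution p os bs A (i , ys) =
  (lookup os i + 3 ≡ᵇ p) ∧ (lookup ys i % 2 ≡ᵇ 1) ∧ (diag bs ys mod2^ p ≡ᵇ A mod2^ p)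

-- The bounds only prune the search: if ord₂ b = o then b y² mod 2^p depends only on y mod 2^(p-o-1).
candidates : ∀ {n} → ℕ → Vec ℕ n → List (Fin n × Vec ℕ n)
candidates {n} p os = cartesianProduct (filterᵇ (λ i → lookup os i + 3 ≡ᵇ p) (allFin n))
  (vectorsBelow (map (λ o → 2 ^ (p ∸ suc o) ⊔ 2) os))

PivotSolvable : ∀ {n} → ℕ → Vec ℕ n → Vec ℕ n → ℕ → Set
PivotSolvable p os bs A = T (any (isPivotSolution p os bs A) (candidates p os))

record PivotedSolution {n} (bs : Vec ℤ₂ n) (os : Vec ℕ n) (a : ℤ₂) : Set where
  field
    pivot : Fin n
    ys : Vec ℕ n
    pivot-odd : lookup ys pivot % 2 ≡ 1
    solution : SolutionMod2^ bs a (lookup os pivot + 3) ys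

pivotSolvable⇒pivotedSolution : ∀ {n p os} {bs : Vec ℤ₂ n} {a} →
  PivotSolvable p os (residues bs p) (res a p) → PivotedSolution bs os a
pivotSolvable⇒pivotedSolution {p = p} {os} {bs} {a} solvable
  with satisfied (any⁻ (isPivotSolution p os (residues bs p) (res a p)) (candidates p os) solvable)
... | (i , ys) , checked with Equivalence.to T-∧ checked
... | level-ok , rest with Equivalence.to T-∧ rest
... | odd , solves = record
  { pivot = i
  ; ys = ys
  ; pivot-odd = ≡ᵇ⇒≡ _ _ odd
  ; solution = subst (λ q → SolutionMod2^ bs a q ys) (sym (≡ᵇ⇒≡ _ _ level-ok)) (mod-≡ (≡ᵇ⇒≡ _ _ solves))
  }

-- Residues modulo 2^p of elements of order o; the ⊓ covers p ≤ o, where they vanish.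
OrderResidue : ℕ → ℕ → ℕ → Set
OrderResidue p o r = r ≡ 2 ^ o [mod2^ suc o ⊓ p ]

HasOrd₂⇒OrderResidue : ∀ {x o} p → HasOrd₂ x o → OrderResidue p o (res x p)
HasOrd₂⇒OrderResidue {x} {o} p ord = begin
  res x p             ≈⟨ res-≡mod x (m⊓n≤n (suc o) p) ⟩
  res x (suc o ⊓ p)   ≈⟨ res-≡mod x (m⊓n≤m (suc o) p) ⟨
  res x (suc o)       ≡⟨ HasOrd₂⇒res-suc {x} ord ⟩
  2 ^ o               ∎
  where open ≡mod-Reasoning (suc o ⊓ p)

TargetResidue : ℕ → Set
TargetResidue A = (A mod2^ 1 ≡ 0) × (A mod2^ 3 ≢ 0)

LiftOf : ℕ × ℕ → ℕ → Set
LiftOf (o , r) r′ = OrderResidue 5 o r′ × r′ mod2^ 4 ≡ r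

AllVec : {X : Set} → (X → ℕ → Set) → ℕ → ∀ {n} → Vec X n → (Vec ℕ n → Set) → Set
AllVec Q bound [] P = P []
AllVec Q bound (x ∷ xs) P = ∀ {r} → r < bound → Q x r → AllVec Q bound xs (λ rs → P (r ∷ rs))

allVec? : {X : Set} {Q : X → ℕ → Set} → (∀ x r → Dec (Q x r)) →
  ∀ bound {n} (xs : Vec X n) {P : Vec ℕ n → Set} → (∀ v → Dec (P v)) → Dec (AllVec Q bound xs P)
allVec? Q? bound [] P? = P? []
allVec? Q? bound (x ∷ xs) P? = allUpTo? (λ r → Q? x r →-dec allVec? Q? bound xs (λ rs → P? (r ∷ rs))) bound

AllVec-elim : ∀ {X : Set} {Q : X → ℕ → Set} {bound n} {xs : Vec X n} {P : Vec ℕ n → Set} →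
  AllVec Q bound xs P → ∀ {v} → Pointwise (λ x r → r < bound × Q x r) xs v → P v
AllVec-elim all [] = all
AllVec-elim all ((r<bound , qr) ∷ rest) = AllVec-elim (all r<bound qr) rest

-- A pivot of order 1 needs the data modulo 16 only; the lifts modulo 32 are inspected only where none exists.
Certificate : ∀ {n} → Vec ℕ n → Set
Certificate os = AllVec (OrderResidue 4) 16 os λ bs → ∀ {A} → A < 16 → TargetResidue A →
  PivotSolvable 4 os bs A ⊎
  AllVec LiftOf 32 (zip os bs) (λ bs′ → ∀ {A′} → A′ < 32 → A′ mod2^ 4 ≡ A → PivotSolvable 5 os bs′ A′)

certificate? : ∀ {n} (os : Vec ℕ n) → Dec (Certificate os)
certificate? os = allVec? orderResidue? 16 os λ bs → allUpTo? (λ A → target? A →-dec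
  (T? _ ⊎-dec allVec? liftOf? 32 (zip os bs) λ bs′ → allUpTo? (λ A′ → (A′ mod2^ 4 ≟ A) →-dec T? _) 32)) 16
  where
  orderResidue? : ∀ o r → Dec (OrderResidue 4 o r)
  orderResidue? o r = r ≡mod? 2 ^ o
  target? : ∀ A → Dec (TargetResidue A)
  target? A = (A mod2^ 1 ≟ 0) ×-dec ¬? (A mod2^ 3 ≟ 0)
  liftOf? : ∀ x r′ → Dec (LiftOf x r′)
  liftOf? (o , r) r′ = (r′ ≡mod? 2 ^ o) ×-dec (r′ mod2^ 4 ≟ r)

orders : Quad → Vec ℕ 4
orders ⟨ o₁ , o₂ , o₃ , o₄ ⟩ = o₁ ∷ o₂ ∷ o₃ ∷ o₄ ∷ []

certificates : ListAll.All (Certificate ∘ orders) Δ₂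
certificates = toWitness {a? = ListAll.all? (certificate? ∘ orders) Δ₂} _

orderResidues : ∀ {n} {bs : Vec ℤ₂ n} {os : Vec ℕ n} p → Pointwise HasOrd₂ bs os →
  Pointwise (λ o r → r < 2 ^ p × OrderResidue p o r) os (residues bs p)
orderResidues p [] = []
orderResidues p (_∷_ {x = b} ord ords) = (res-bound b p , HasOrd₂⇒OrderResidue {b} p ord) ∷ orderResidues p ords

liftResidues : ∀ {n} {bs : Vec ℤ₂ n} {os : Vec ℕ n} → Pointwise HasOrd₂ bs os →
  Pointwise (λ x r → r < 32 × LiftOf x r) (zip os (residues bs 4)) (residues bs 5)
liftResidues [] = []
liftResidues (_∷_ {x = b} ord ords) =
  (res-bound b 5 , HasOrd₂⇒OrderResidue {b} 5 ord , res-mod2^-≤ b (n≤1+n 4)) ∷ liftResidues ords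

certified-pivotedSolution : ∀ {n} {os : Vec ℕ n} → Certificate os → ∀ {bs} → Pointwise HasOrd₂ bs os →
  ∀ {a} → res a 1 ≡ 0 → res a 3 ≢ 0 → PivotedSolution bs os a
certified-pivotedSolution cert ords {a} res₁≡0 res₃≢0
  with AllVec-elim cert (orderResidues 4 ords) (res-bound a 4) target
  where
  target : TargetResidue (res a 4)
  target = trans (res-mod2^-≤ a (s≤s z≤n)) res₁≡0 ,
    λ e → res₃≢0 (trans (sym (res-mod2^-≤ a (s≤s (s≤s (s≤s z≤n))))) e)
... | inj₁ solvable = pivotSolvable⇒pivotedSolution solvable
... | inj₂ lifts =
  pivotSolvable⇒pivotedSolution (AllVec-elim lifts (liftResidues ords) (res-bound a 5) (res-mod2^-≤ a (n≤1+n 4)))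

-- Locating the scale and gluing the lifts

-- ord₂ a ∈ {2j + 1, 2j + 2}, i.e. a = 4^j A with A ∈ 2ℤ₂ ∖ 8ℤ₂.
record Scale (a : ℤ₂) (j : ℕ) : Set where
  field
    low : res a (j + j + 1) ≡ 0
    high : res a (j + j + 3) ≢ 0

ScaleSearch : ℤ₂ → ℕ → Set
ScaleSearch a k = Σ ℕ (Scale a) ⊎ res a (k + k + 3) ≡ 0

scaleAt : ∀ {a} j → res a (j + j + 1) ≡ 0 → Dec (res a (j + j + 3) ≡ 0) → ScaleSearch a j
scaleAt j low (yes high≡0) = inj₂ high≡0
scaleAt j low (no high≢0) = inj₁ (j , record { low = low ; high = high≢0 })

res≡0-step : ∀ a k → res a (k + k + 3) ≡ 0 → res a (suc k + suc k + 1) ≡ 0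
res≡0-step a k = subst (λ m → res a m ≡ 0) (index k)
  where
  index : ∀ k → k + k + 3 ≡ suc k + suc k + 1
  index = solve-∀

scaleSearch-step : ∀ {a} k → ScaleSearch a k → ScaleSearch a (suc k)
scaleSearch-step k (inj₁ found) = inj₁ found
scaleSearch-step {a} k (inj₂ res≡0) = scaleAt (suc k) (res≡0-step a k res≡0) (res a (suc k + suc k + 3) ≟ 0)

scaleSearch : ∀ a → Even₂ a → ∀ k → ScaleSearch a k
scaleSearch a ev zero = scaleAt 0 ev (res a 3 ≟ 0)
scaleSearch a ev (suc k) = scaleSearch-step k (scaleSearch a ev k)

module Assembly {n} (bs : Vec ℤ₂ n) {os : Vec ℕ n} (ords : Pointwise HasOrd₂ bs os) (cert : Certificate os)
  (a : ℤ₂) (ev : Even₂ a) where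

  module AtScale {j} (scale : Scale a j) where
    open Scale scale

    res≡0 : res a (j + j) ≡ 0
    res≡0 = trans (sym (res-mod2^-≤ a (m≤m+n (j + j) 1)))
      (trans (cong (_mod2^ (j + j)) low) (m*n%n≡0 0 (2 ^ (j + j)) {{m^n≢0 2 (j + j)}}))

    pivoted : PivotedSolution bs os (a /2^ (j + j))
    pivoted = certified-pivotedSolution cert ords
      (2^*≡0⇒≡0 (j + j) (trans (sym (res-/2^ a (j + j) res≡0 1)) low))
      (λ res′₃≡0 → high (trans (res-/2^ a (j + j) res≡0 3)
        (trans (cong (2 ^ (j + j) *_) res′₃≡0) (*-zeroʳ (2 ^ (j + j))))))
    open PivotedSolution pivoted

    open HenselLift bs a pivot (Pointwise.lookup ords pivot) j public

    base : Approx 0 (map (2 ^ j *_) ys)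
    base = record
      { solution = solution-2^* {bs = bs} {a} j (lookup os pivot + 3) res≡0 solution
      ; pivot-∥ = subst (2^ j ∥_) (sym (lookup-map pivot (2 ^ j *_) ys))
          (subst (2^_∥ 2 ^ j * lookup ys pivot) (+-identityʳ j) (∥-* (2^∥2^ j) (≡2^-mod⇒∥ {0} (mod-≡ pivot-odd))))
      ; all-∣ = map⁺ (All.universal (λ y → m∣m*n y) ys)
      }

    approximation : ∀ k → Σ (Vec ℕ n) (Approx k)
    approximation = lifted base

    approximation-∣ : ∀ k → All (2 ^ j ∣_) (proj₁ (approximation k))
    approximation-∣ k = Approx.all-∣ (proj₂ (approximation k))

  glue : ∀ k → ScaleSearch a k → Vec ℕ n
  glue k (inj₁ (j , scale)) = proj₁ (AtScale.approximation scale k)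
  glue k (inj₂ _) = replicate n 0

  glue-≋ : ∀ k s → glue (suc k) (scaleSearch-step k s) ≋ glue k s [mod2^ k ]
  glue-≋ k (inj₁ (j , scale)) = AtScale.lifted-≋ scale (AtScale.base scale) k
  glue-≋ k (inj₂ res≡0) = found-now (res a (suc k + suc k + 3) ≟ 0)
    where
    found-now : ∀ d → glue (suc k) (scaleAt (suc k) (res≡0-step a k res≡0) d) ≋ replicate n 0 [mod2^ k ]
    found-now (yes _) = ≋mod-refl
    found-now (no high≢0) =
      All-∣⇒≋0 (n≤1+n k)
        (AtScale.approximation-∣ (record { low = res≡0-step a k res≡0 ; high = high≢0 }) (suc k))

  glue-solution : ∀ k s → SolutionMod2^ bs a k (glue k s)
  glue-solution k (inj₁ (j , scale)) =
    solution-weaken {bs = bs} {a} (m≤m+n k _) (Approx.solution (proj₂ (approximation k)))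
    where open AtScale scale
  glue-solution k (inj₂ res≡0) = ≡mod-trans (≡⇒≡mod (diag-replicate-0 (residues bs k)))
    (≡mod-trans (≡⇒≡mod (sym res≡0)) (res-≡mod a (≤-trans (m≤m+n k k) (m≤m+n (k + k) 3))))

  solutions : ℕ → Vec ℕ n
  solutions k = glue k (scaleSearch a ev k)

  solutions-≋ : ∀ k → solutions (suc k) ≋ solutions k [mod2^ k ]
  solutions-≋ k = glue-≋ k (scaleSearch a ev k)

  solutions-solve : ∀ k → SolutionMod2^ bs a k (solutions k)
  solutions-solve k = glue-solution k (scaleSearch a ev k)

represents4-of-coherent : ∀ {b₁ b₂ b₃ b₄} a (Y : ℕ → Vec ℕ 4) → (∀ k → Y (suc k) ≋ Y k [mod2^ k ]) →
  (∀ k → SolutionMod2^ (b₁ ∷ b₂ ∷ b₃ ∷ b₄ ∷ []) a k (Y k)) → Represents4 b₁ b₂ b₃ b₄ a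
represents4-of-coherent {b₁} {b₂} {b₃} {b₄} a Y coherent solution =
  y zero , y (suc zero) , y (suc (suc zero)) , y (suc (suc (suc zero))) ,
  λ k → trans (cong (_mod2^ k) (regroup k)) (trans (residues-≡ (residue-solution k)) (res-mod2^ a k))
  where
  y : Fin 4 → ℤ₂
  y m = fromCoherent (λ k → lookup (Y k) m) (λ k → Pointwise.lookup (coherent k) m)

  residue-solution : ∀ k → SolutionMod2^ (b₁ ∷ b₂ ∷ b₃ ∷ b₄ ∷ []) a k (residues (tabulate y) k)
  residue-solution k = ≡mod-trans (diag-cong-mod ≋mod-refl (tabulate-mod2^-≋ (Y k))) (solution k)

  sum₄ : ∀ p₁ p₂ p₃ p₄ → p₁ + p₂ + p₃ + p₄ ≡ p₁ + (p₂ + (p₃ + (p₄ + 0)))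
  sum₄ = solve-∀

  term : ℕ → ℤ₂ → Fin 4 → ℕ
  term k b m = res b k * (res (y m) k * res (y m) k)

  regroup : ∀ k → term k b₁ zero + term k b₂ (suc zero) + term k b₃ (suc (suc zero)) + term k b₄ (suc (suc (suc zero)))
                 ≡ diag (residues (b₁ ∷ b₂ ∷ b₃ ∷ b₄ ∷ []) k) (residues (tabulate y) k)
  regroup k = sum₄ (term k b₁ zero) (term k b₂ (suc zero))
                   (term k b₃ (suc (suc zero))) (term k b₄ (suc (suc (suc zero))))

proposition4p8 : (b₁ b₂ b₃ b₄ : ℤ₂) (o₁ o₂ o₃ o₄ : ℕ) →
    HasOrd₂ b₁ o₁ → HasOrd₂ b₂ o₂ → HasOrd₂ b₃ o₃ → HasOrd₂ b₄ o₄ →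
    ⟨ o₁ , o₂ , o₃ , o₄ ⟩ ∈ Δ₂ →
    EvenUniversal4 b₁ b₂ b₃ b₄
proposition4p8 b₁ b₂ b₃ b₄ o₁ o₂ o₃ o₄ h₁ h₂ h₃ h₄ mem a ev =
  represents4-of-coherent {b₁} {b₂} {b₃} {b₄} a solutions solutions-≋ solutions-solve
  where
  open Assembly (b₁ ∷ b₂ ∷ b₃ ∷ b₄ ∷ []) (h₁ ∷ h₂ ∷ h₃ ∷ h₄ ∷ []) (ListAll.lookup certificates mem) a ev
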